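{- Let $b$ be an odd integer such that $m=8b^3+3$ is squarefree, and let $E$ be the elliptic curve $y^2=x^3-m$ over $\mathbb{Q}$. Let $P,Q\in E(\mathbb{Q})$ be independent points with odd denominators, i.e. $P=(r_1/t_1^2,s_1/t_1^3)$ and $Q=(r_2/t_2^2,s_2/t_2^3)$ with $\gcd(r_i,t_i)=\gcd(s_i,t_i)=1$ and $t_1,t_2$ odd. Then $P+Q=(r/t^2,\,s/t^3)$ with integers $r,s,t$ satisfying $\gcd(r,t)=\gcd(s,t)=1$ and $2\mid t$. -}

module Defs where

open import Data.Nat as ℕ using (ℕ; zero; suc)
open import Data.Integer as ℤ using (ℤ; +_; -[1+_]; 0ℤ; 1ℤ)
open import Data.Integer.GCD using (gcd)
open import Data.Integer.Divisibility using (_∣_)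
open import Data.Rational using (ℚ; _/_; 0ℚ; _+_; _-_; _*_; -_; 1/_; ≢-nonZero)
open import Data.Rational.Properties using (_≟_)
open import Data.Product using (_×_)
open import Data.Unit using (⊤)
open import Data.Empty using (⊥)
open import Relation.Nullary using (¬_; yes; no)
open import Relation.Binary.PropositionalEquality using (_≡_; _≢_)

toℚ : ℤ → ℚ
toℚ z = z / 1

-- total inverse (only ever applied to nonzero arguments below)
inv : ℚ → ℚ
inv q with q ≟ 0ℚ
... | yes _ = 0ℚ
... | no q≢0 = 1/_ q {{≢-nonZero q≢0}}

-- projective points of a short Weierstrass curve y^2 = x^3 + A x + B
data Pt : Set where
  O  : Pt
  pt : ℚ → ℚ → Pt

OnE : ℤ → Pt → Set
OnE m O = ⊤
OnE m (pt x y) = y * y ≡ x * x * x - toℚ m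

-- chord-and-tangent group law for y^2 = x^3 + B (coefficient A = 0)
add : Pt → Pt → Pt
add O Q = Q
add (pt x₁ y₁) O = pt x₁ y₁
add (pt x₁ y₁) (pt x₂ y₂) with x₁ ≟ x₂
... | no _ = third ((y₂ - y₁) * inv (x₂ - x₁))
  where
  third : ℚ → Pt
  third l = let x₃ = l * l - x₁ - x₂ in pt x₃ (l * (x₁ - x₃) - y₁)
... | yes _ with y₁ + y₂ ≟ 0ℚ
...   | yes _ = O
...   | no _ = third ((toℚ (+ 3) * x₁ * x₁) * inv (toℚ (+ 2) * y₁))
  where
  third : ℚ → Pt
  third l = let x₃ = l * l - x₁ - x₂ in pt x₃ (l * (x₁ - x₃) - y₁)

neg : Pt → Pt
neg O = O
neg (pt x y) = pt x (- y)

natMul : ℕ → Pt → Pt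
natMul zero P = O
natMul (suc n) P = add P (natMul n P)

zMul : ℤ → Pt → Pt
zMul (+ n) P = natMul n P
zMul -[1+ n ] P = neg (natMul (suc n) P)

Independent : Pt → Pt → Set
Independent P Q = ∀ (a b : ℤ) → add (zMul a P) (zMul b Q) ≡ O → (a ≡ 0ℤ × b ≡ 0ℤ)

HasForm : Pt → ℤ → ℤ → ℤ → Set
HasForm O r s t = ⊥
HasForm (pt x y) r s t =
  t ≢ 0ℤ × x * toℚ (t ℤ.* t) ≡ toℚ r × y * toℚ (t ℤ.* t ℤ.* t) ≡ toℚ s
  × gcd r t ≡ 1ℤ × gcd s t ≡ 1ℤ

Odd : ℤ → Set
Odd z = ¬ (+ 2 ∣ z)

SquareFree : ℤ → Set
SquareFree m = m ≢ 0ℤ × (∀ (d : ℕ) → (+ d ℤ.* + d) ∣ m → d ≡ 1)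

module Submission where

-- Independence forces x₁ ≠ x₂, so P + Q = (x₃, y₃) comes from the chord of
-- slope l.  As m ≡ 3 (mod 8) and t₁, t₂ are odd, each xᵢ = rᵢ/tᵢ² is a 2-adic
-- unit and each yᵢ = sᵢ/tᵢ³ is divisible by 2.  On the curve
-- l(y₁ + y₂) = x₁² + x₁x₂ + x₂², a unit over an even number, so l and then
-- x₃ = l² - x₁ - x₂ have negative 2-adic valuation, i.e. even reduced
-- denominator.  Every rational point of E_m is (p/t², u/t³) in lowest terms,
-- so this denominator is t² and 2 ∣ t.  Only m ≡ 3 (mod 8) is used.

open import Defs
open import Data.Product using (∃-syntax; _×_; _,_; proj₁; proj₂)
open import Data.Sum using (_⊎_; inj₁; inj₂)
open import Data.Empty using (⊥; ⊥-elim)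
open import Relation.Nullary using (¬_; yes; no)
open import Relation.Binary.PropositionalEquality
open import Tactic.RingSolver using (solve-∀)
open import Data.Nat.Tactic.RingSolver using () renaming (ring to ℕ-ring)
open import Data.Integer.Tactic.RingSolver using () renaming (ring to ℤ-ring)
open import Data.Maybe.Base using (Maybe; just; nothing)
import Data.Rational as ℚ
import Data.Rational.Properties as ℚP
import Tactic.RingSolver.Core.AlmostCommutativeRing as ACR
open import Level using (0ℓ)

ℚ-ring : ACR.AlmostCommutativeRing 0ℓ 0ℓ
ℚ-ring = ACR.fromCommutativeRing ℚP.+-*-commutativeRing isZero
  where
  isZero : ∀ x → Maybe (ℚ.0ℚ ≡ x)
  isZero x with x ℚP.≟ ℚ.0ℚ
  ... | yes x≡0 = just (sym x≡0)
  ... | no _ = nothing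

-- Parity of integers.  "Even" is signed divisibility by 2, and an odd
-- number is one whose predecessor is even; in this form all the closure
-- properties below are instances of the divisibility lemmas of the library.
module Parity where
  open import Data.Nat as ℕ using (zero; suc)
  import Data.Nat.Divisibility as ℕ∣
  open import Data.Integer
  import Data.Integer.Properties as ℤ
  open import Data.Integer.DivMod using (_%ℕ_; _/ℕ_; a≡a%ℕn+[a/ℕn]*n; n%ℕd<d)
  open import Data.Integer.Divisibility.Signed

  IsEven : ℤ → Set
  IsEven z = + 2 ∣ z

  record IsOdd (z : ℤ) : Set where
    constructor odd
    field pred-even : IsEven (z - + 1)

  2∤1 : ¬ (+ 2 ∣ + 1)
  2∤1 d with ∣⇒∣ᵤ d
  ... | ℕ∣.divides zero ()
  ... | ℕ∣.divides (suc _) ()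

  8∤4 : ¬ (+ 8 ∣ + 4)
  8∤4 d with ∣⇒∣ᵤ d
  ... | ℕ∣.divides zero ()
  ... | ℕ∣.divides (suc _) ()

  even-odd-disjoint : ∀ {z} → IsEven z → IsOdd z → ⊥
  even-odd-disjoint {z} ev (odd od) =
    2∤1 (subst (+ 2 ∣_) (identity z) (∣m∣n⇒∣m-n ev od))
    where
    identity : ∀ z → z - (z - + 1) ≡ + 1
    identity = solve-∀ ℤ-ring

  parity : ∀ z → IsEven z ⊎ IsOdd z
  parity z with z %ℕ 2 | a≡a%ℕn+[a/ℕn]*n z 2 | n%ℕd<d z 2
  ... | 0 | z≡q*2 | _ = inj₁ (divides (z /ℕ 2) (trans z≡q*2 (ℤ.+-identityˡ _)))
  ... | 1 | z≡1+q*2 | _ = inj₂ (odd (divides (z /ℕ 2) (trans (cong (_- + 1) z≡1+q*2) (identity (z /ℕ 2)))))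
    where
    identity : ∀ q → + 1 + q * + 2 - + 1 ≡ q * + 2
    identity = solve-∀ ℤ-ring
  ... | suc (suc _) | _ | ℕ.s≤s (ℕ.s≤s ())

  odd⇒IsOdd : ∀ {z} → Odd z → IsOdd z
  odd⇒IsOdd {z} ¬2∣z with parity z
  ... | inj₁ ev = ⊥-elim (¬2∣z (∣⇒∣ᵤ ev))
  ... | inj₂ od = od

  odd*odd : ∀ {a b} → IsOdd a → IsOdd b → IsOdd (a * b)
  odd*odd {a} {b} (odd oa) (odd ob) =
    odd (subst (+ 2 ∣_) (identity a b) (∣m∣n⇒∣m+n (∣m⇒∣m*n b oa) ob))
    where
    identity : ∀ a b → (a - + 1) * b + (b - + 1) ≡ a * b - + 1
    identity = solve-∀ ℤ-ring

  odd+odd : ∀ {a b} → IsOdd a → IsOdd b → IsEven (a + b)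
  odd+odd {a} {b} (odd oa) (odd ob) =
    subst (+ 2 ∣_) (identity a b) (∣m∣n⇒∣m+n (∣m∣n⇒∣m+n oa ob) ∣-refl)
    where
    identity : ∀ a b → (a - + 1) + (b - + 1) + + 2 ≡ a + b
    identity = solve-∀ ℤ-ring

  odd-odd : ∀ {a b} → IsOdd a → IsOdd b → IsEven (a - b)
  odd-odd {a} {b} (odd oa) (odd ob) = subst (+ 2 ∣_) (identity a b) (∣m∣n⇒∣m-n oa ob)
    where
    identity : ∀ a b → (a - + 1) - (b - + 1) ≡ a - b
    identity = solve-∀ ℤ-ring

  even+odd : ∀ {a b} → IsEven a → IsOdd b → IsOdd (a + b)
  even+odd {a} {b} ea (odd ob) = odd (subst (+ 2 ∣_) (identity a b) (∣m∣n⇒∣m+n ea ob))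
    where
    identity : ∀ a b → a + (b - + 1) ≡ a + b - + 1
    identity = solve-∀ ℤ-ring

  odd-even : ∀ {a b} → IsOdd a → IsEven b → IsOdd (a - b)
  odd-even {a} {b} (odd oa) eb = odd (subst (+ 2 ∣_) (identity a b) (∣m∣n⇒∣m-n oa eb))
    where
    identity : ∀ a b → (a - + 1) - b ≡ a - b - + 1
    identity = solve-∀ ℤ-ring

  even-odd : ∀ {a b} → IsEven a → IsOdd b → IsOdd (a - b)
  even-odd {a} {b} ea (odd ob) =
    odd (subst (+ 2 ∣_) (identity a b) (∣m∣n⇒∣m-n (∣m∣n⇒∣m-n ea ob) ∣-refl))
    where
    identity : ∀ a b → a - (b - + 1) - + 2 ≡ a - b - + 1
    identity = solve-∀ ℤ-ring

  consecutive-even : ∀ k → IsEven (k * (k + + 1))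
  consecutive-even k with parity k
  ... | inj₁ k-even = ∣m⇒∣m*n (k + + 1) k-even
  ... | inj₂ (odd k-1-even) =
    ∣n⇒∣m*n k (subst (+ 2 ∣_) (identity k) (∣m∣n⇒∣m+n k-1-even ∣-refl))
    where
    identity : ∀ k → k - + 1 + + 2 ≡ k + + 1
    identity = solve-∀ ℤ-ring

  odd-square : ∀ {z} → IsOdd z → + 8 ∣ z * z - + 1
  odd-square {z} (odd (divides k z-1≡2k)) with consecutive-even k
  ... | divides j k[k+1]≡2j = divides j (begin
    z * z - + 1                  ≡⟨ expand z ⟩
    (z - + 1) * (z - + 1 + + 2)  ≡⟨ cong (λ w → w * (w + + 2)) z-1≡2k ⟩
    k * + 2 * (k * + 2 + + 2)    ≡⟨ factor k ⟩
    + 4 * (k * (k + + 1))        ≡⟨ cong (+ 4 *_) k[k+1]≡2j ⟩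
    + 4 * (j * + 2)              ≡⟨ regroup j ⟩
    j * + 8                      ∎)
    where
    open ≡-Reasoning
    expand : ∀ z → z * z - + 1 ≡ (z - + 1) * (z - + 1 + + 2)
    expand = solve-∀ ℤ-ring
    factor : ∀ k → k * + 2 * (k * + 2 + + 2) ≡ + 4 * (k * (k + + 1))
    factor = solve-∀ ℤ-ring
    regroup : ∀ j → + 4 * (j * + 2) ≡ j * + 8
    regroup = solve-∀ ℤ-ring

  three-mod-eight-odd : ∀ k → IsOdd (+ 8 * k + + 3)
  three-mod-eight-odd k = odd (divides (+ 4 * k + + 1) (identity k))
    where
    identity : ∀ k → + 8 * k + + 3 - + 1 ≡ (+ 4 * k + + 1) * + 2
    identity = solve-∀ ℤ-ring

  -- Three parity combinations fail modulo 2; the fourth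
  -- (r even, s odd) fails modulo 8 because odd squares are 1 modulo 8.
  point-parity : ∀ k r s c → IsOdd c →
    s * s ≡ r * r * r - (+ 8 * k + + 3) * (c * c) → IsOdd r × IsEven s
  point-parity k r s c c-odd curve = classify (parity r) (parity s)
    where
    open ≡-Reasoning
    m = + 8 * k + + 3
    mc²-odd : IsOdd (m * (c * c))
    mc²-odd = odd*odd (three-mod-eight-odd k) (odd*odd c-odd c-odd)
    -- with r = 2d and s odd:  4 = r³ - m(c² - 1) - 8k - (s² - 1) ≡ 0 (mod 8)
    eight∣four : ∀ d → r ≡ d * + 2 → IsOdd s → + 8 ∣ + 4
    eight∣four d r≡2d s-odd = subst (+ 8 ∣_) four
      (∣m∣n⇒∣m-n (∣m∣n⇒∣m-n (∣m∣n⇒∣m-n r³ (∣n⇒∣m*n m (odd-square c-odd))) (∣m⇒∣m*n k ∣-refl))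
                 (odd-square s-odd))
      where
      r³ : + 8 ∣ r * r * r
      r³ = divides (d * d * d) (trans (cong (λ w → w * w * w) r≡2d) (cube d))
        where
        cube : ∀ d → d * + 2 * (d * + 2) * (d * + 2) ≡ d * d * d * + 8
        cube = solve-∀ ℤ-ring
      four : r * r * r - m * (c * c - + 1) - + 8 * k - (s * s - + 1) ≡ + 4
      four = begin
        r * r * r - m * (c * c - + 1) - + 8 * k - (s * s - + 1)      ≡⟨ rearrange r s c k ⟩
        (r * r * r - m * (c * c)) - s * s + + 4                      ≡⟨ cong (λ w → (r * r * r - m * (c * c)) - w + + 4) curve ⟩
        (r * r * r - m * (c * c)) - (r * r * r - m * (c * c)) + + 4  ≡⟨ cancel (r * r * r - m * (c * c)) ⟩
        + 4                                                          ∎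
        where
        rearrange : ∀ r s c k → r * r * r - (+ 8 * k + + 3) * (c * c - + 1) - + 8 * k - (s * s - + 1)
                              ≡ (r * r * r - (+ 8 * k + + 3) * (c * c)) - s * s + + 4
        rearrange = solve-∀ ℤ-ring
        cancel : ∀ w → w - w + + 4 ≡ + 4
        cancel = solve-∀ ℤ-ring
    classify : IsEven r ⊎ IsOdd r → IsEven s ⊎ IsOdd s → IsOdd r × IsEven s
    classify (inj₂ r-odd) (inj₁ s-even) = r-odd , s-even
    classify (inj₂ r-odd) (inj₂ s-odd) = ⊥-elim (even-odd-disjoint
      (subst IsEven (sym curve) (odd-odd (odd*odd (odd*odd r-odd r-odd) r-odd) mc²-odd))
      (odd*odd s-odd s-odd))
    classify (inj₁ r-even) (inj₁ s-even) = ⊥-elim (even-odd-disjoint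
      (∣m⇒∣m*n s s-even)
      (subst IsOdd (sym curve) (even-odd (∣m⇒∣m*n r (∣m⇒∣m*n r r-even)) mc²-odd)))
    classify (inj₁ (divides d r≡2d)) (inj₂ s-odd) = ⊥-elim (8∤4 (eight∣four d r≡2d s-odd))


module Embedding where
  open import Data.Integer as ℤ using (ℤ; +_)
  open import Data.Rational using (mkℚ; _+_; _-_; _*_; -_; ↥_; ↧_; toℚᵘ)
  open import Data.Rational.Properties
    using (↥p/↧p≡p; toℚᵘ-injective; toℚᵘ-homo-+; toℚᵘ-homo-*; toℚᵘ-homo‿-)
  open import Data.Rational.Unnormalised as ℚᵘ using (mkℚᵘ; *≡*; _≃_)
  open import Data.Rational.Unnormalised.Properties using (module ≃-Reasoning)
  import Data.Nat.Coprimality as ℕC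

  toℚᵘ-toℚ : ∀ z → toℚᵘ (toℚ z) ≡ mkℚᵘ z 0
  toℚᵘ-toℚ z = cong toℚᵘ (↥p/↧p≡p (mkℚ z 0 (ℕC.sym (ℕC.1-coprimeTo ℤ.∣ z ∣))))

  toℚ-injective : ∀ {a b} → toℚ a ≡ toℚ b → a ≡ b
  toℚ-injective {a} {b} eq =
    cong ℚᵘ.↥_ (trans (sym (toℚᵘ-toℚ a)) (trans (cong toℚᵘ eq) (toℚᵘ-toℚ b)))

  toℚ-+ : ∀ a b → toℚ (a ℤ.+ b) ≡ toℚ a + toℚ b
  toℚ-+ a b = toℚᵘ-injective (begin
    toℚᵘ (toℚ (a ℤ.+ b))            ≡⟨ toℚᵘ-toℚ (a ℤ.+ b) ⟩
    mkℚᵘ (a ℤ.+ b) 0                ≈⟨ *≡* (identity a b) ⟩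
    mkℚᵘ a 0 ℚᵘ.+ mkℚᵘ b 0           ≡⟨ cong₂ ℚᵘ._+_ (toℚᵘ-toℚ a) (toℚᵘ-toℚ b) ⟨
    toℚᵘ (toℚ a) ℚᵘ.+ toℚᵘ (toℚ b)   ≈⟨ toℚᵘ-homo-+ (toℚ a) (toℚ b) ⟨
    toℚᵘ (toℚ a + toℚ b)             ∎)
    where
    open ≃-Reasoning
    identity : ∀ a b → (a ℤ.+ b) ℤ.* + 1 ≡ (a ℤ.* + 1 ℤ.+ b ℤ.* + 1) ℤ.* + 1
    identity = solve-∀ ℤ-ring

  toℚ-* : ∀ a b → toℚ (a ℤ.* b) ≡ toℚ a * toℚ b
  toℚ-* a b = toℚᵘ-injective (begin
    toℚᵘ (toℚ (a ℤ.* b))            ≡⟨ toℚᵘ-toℚ (a ℤ.* b) ⟩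
    mkℚᵘ (a ℤ.* b) 0                ≈⟨ *≡* (identity a b) ⟩
    mkℚᵘ a 0 ℚᵘ.* mkℚᵘ b 0           ≡⟨ cong₂ ℚᵘ._*_ (toℚᵘ-toℚ a) (toℚᵘ-toℚ b) ⟨
    toℚᵘ (toℚ a) ℚᵘ.* toℚᵘ (toℚ b)   ≈⟨ toℚᵘ-homo-* (toℚ a) (toℚ b) ⟨
    toℚᵘ (toℚ a * toℚ b)             ∎)
    where
    open ≃-Reasoning
    identity : ∀ a b → (a ℤ.* b) ℤ.* + 1 ≡ (a ℤ.* b) ℤ.* (+ 1 ℤ.* + 1)
    identity = solve-∀ ℤ-ring

  toℚ-neg : ∀ a → toℚ (ℤ.- a) ≡ - toℚ a
  toℚ-neg a = toℚᵘ-injective (begin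
    toℚᵘ (toℚ (ℤ.- a))   ≡⟨ toℚᵘ-toℚ (ℤ.- a) ⟩
    ℚᵘ.- mkℚᵘ a 0        ≡⟨ cong ℚᵘ.-_ (toℚᵘ-toℚ a) ⟨
    ℚᵘ.- toℚᵘ (toℚ a)    ≈⟨ toℚᵘ-homo‿- (toℚ a) ⟨
    toℚᵘ (- toℚ a)       ∎)
    where open ≃-Reasoning

  toℚ-- : ∀ a b → toℚ (a ℤ.- b) ≡ toℚ a - toℚ b
  toℚ-- a b = trans (toℚ-+ a (ℤ.- b)) (cong (λ v → toℚ a + v) (toℚ-neg b))

  times-denominator : ∀ x → x * toℚ (↧ x) ≡ toℚ (↥ x)
  times-denominator x@(mkℚ n d _) = toℚᵘ-injective (begin
    toℚᵘ (x * toℚ (↧ x))             ≈⟨ toℚᵘ-homo-* x (toℚ (↧ x)) ⟩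
    mkℚᵘ n d ℚᵘ.* toℚᵘ (toℚ (↧ x))   ≡⟨ cong (mkℚᵘ n d ℚᵘ.*_) (toℚᵘ-toℚ (↧ x)) ⟩
    mkℚᵘ n d ℚᵘ.* mkℚᵘ (↧ x) 0       ≈⟨ *≡* (identity n (↧ x)) ⟩
    mkℚᵘ n 0                         ≡⟨ toℚᵘ-toℚ n ⟨
    toℚᵘ (toℚ n)                     ∎)
    where
    open ≃-Reasoning
    identity : ∀ n e → n ℤ.* e ℤ.* + 1 ≡ n ℤ.* (e ℤ.* + 1)
    identity = solve-∀ ℤ-ring

-- A rational x is represented by an integer fraction n/d (not necessarily
-- reduced, d possibly even) when x·d = n.
module Fractions where
  open import Data.Integer as ℤ using (ℤ; +_)
  open import Data.Rational using (ℚ; _+_; _-_; _*_; ↥_; ↧_)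
  open import Data.Rational.Properties using (*-identityʳ)
  open Embedding

  infix 4 _≈_⁄_
  record _≈_⁄_ (x : ℚ) (n d : ℤ) : Set where
    constructor rep
    field cleared : x * toℚ d ≡ toℚ n

  ≈-reduced : ∀ x → x ≈ ↥ x ⁄ ↧ x
  ≈-reduced x = rep (times-denominator x)

  ≈-integer : ∀ n → toℚ n ≈ n ⁄ + 1
  ≈-integer n = rep (*-identityʳ (toℚ n))

  ≈-cross : ∀ {x a d b e} → x ≈ a ⁄ d → x ≈ b ⁄ e → a ℤ.* e ≡ b ℤ.* d
  ≈-cross {x} {a} {d} {b} {e} (rep x≈a/d) (rep x≈b/e) = toℚ-injective (begin
    toℚ (a ℤ.* e)       ≡⟨ toℚ-* a e ⟩
    toℚ a * toℚ e       ≡⟨ cong (_* toℚ e) x≈a/d ⟨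
    x * toℚ d * toℚ e   ≡⟨ swap x (toℚ d) (toℚ e) ⟩
    x * toℚ e * toℚ d   ≡⟨ cong (_* toℚ d) x≈b/e ⟩
    toℚ b * toℚ d       ≡⟨ toℚ-* b d ⟨
    toℚ (b ℤ.* d)       ∎)
    where
    open ≡-Reasoning
    swap : ∀ x d e → x * d * e ≡ x * e * d
    swap = solve-∀ ℚ-ring

  ≈-* : ∀ {x y a b d e} → x ≈ a ⁄ d → y ≈ b ⁄ e → x * y ≈ a ℤ.* b ⁄ d ℤ.* e
  ≈-* {x} {y} {a} {b} {d} {e} (rep x≈a/d) (rep y≈b/e) = rep (begin
    x * y * toℚ (d ℤ.* e)          ≡⟨ cong (x * y *_) (toℚ-* d e) ⟩
    x * y * (toℚ d * toℚ e)        ≡⟨ regroup x y (toℚ d) (toℚ e) ⟩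
    (x * toℚ d) * (y * toℚ e)      ≡⟨ cong₂ _*_ x≈a/d y≈b/e ⟩
    toℚ a * toℚ b                  ≡⟨ toℚ-* a b ⟨
    toℚ (a ℤ.* b)                  ∎)
    where
    open ≡-Reasoning
    regroup : ∀ x y d e → x * y * (d * e) ≡ (x * d) * (y * e)
    regroup = solve-∀ ℚ-ring

  ≈-+ : ∀ {x y a b d e} → x ≈ a ⁄ d → y ≈ b ⁄ e → x + y ≈ a ℤ.* e ℤ.+ b ℤ.* d ⁄ d ℤ.* e
  ≈-+ {x} {y} {a} {b} {d} {e} (rep x≈a/d) (rep y≈b/e) = rep (begin
    (x + y) * toℚ (d ℤ.* e)                  ≡⟨ cong ((x + y) *_) (toℚ-* d e) ⟩
    (x + y) * (toℚ d * toℚ e)                ≡⟨ regroup x y (toℚ d) (toℚ e) ⟩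
    (x * toℚ d) * toℚ e + (y * toℚ e) * toℚ d  ≡⟨ cong₂ (λ u v → u * toℚ e + v * toℚ d) x≈a/d y≈b/e ⟩
    toℚ a * toℚ e + toℚ b * toℚ d            ≡⟨ cong₂ _+_ (toℚ-* a e) (toℚ-* b d) ⟨
    toℚ (a ℤ.* e) + toℚ (b ℤ.* d)            ≡⟨ toℚ-+ (a ℤ.* e) (b ℤ.* d) ⟨
    toℚ (a ℤ.* e ℤ.+ b ℤ.* d)                ∎)
    where
    open ≡-Reasoning
    regroup : ∀ x y d e → (x + y) * (d * e) ≡ (x * d) * e + (y * e) * d
    regroup = solve-∀ ℚ-ring

  ≈-- : ∀ {x y a b d e} → x ≈ a ⁄ d → y ≈ b ⁄ e → x - y ≈ a ℤ.* e ℤ.- b ℤ.* d ⁄ d ℤ.* e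
  ≈-- {x} {y} {a} {b} {d} {e} (rep x≈a/d) (rep y≈b/e) = rep (begin
    (x - y) * toℚ (d ℤ.* e)                  ≡⟨ cong ((x - y) *_) (toℚ-* d e) ⟩
    (x - y) * (toℚ d * toℚ e)                ≡⟨ regroup x y (toℚ d) (toℚ e) ⟩
    (x * toℚ d) * toℚ e - (y * toℚ e) * toℚ d  ≡⟨ cong₂ (λ u v → u * toℚ e - v * toℚ d) x≈a/d y≈b/e ⟩
    toℚ a * toℚ e - toℚ b * toℚ d            ≡⟨ cong₂ _-_ (toℚ-* a e) (toℚ-* b d) ⟨
    toℚ (a ℤ.* e) - toℚ (b ℤ.* d)            ≡⟨ toℚ-- (a ℤ.* e) (b ℤ.* d) ⟨
    toℚ (a ℤ.* e ℤ.- b ℤ.* d)                ∎)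
    where
    open ≡-Reasoning
    regroup : ∀ x y d e → (x - y) * (d * e) ≡ (x * d) * e - (y * e) * d
    regroup = solve-∀ ℚ-ring

-- Coarse 2-adic valuation classes of rationals, each witnessed by a
-- representing fraction with prescribed parities of numerator and
-- denominator:  Unit₂ (odd/odd, valuation 0),  Even₂ (even/odd, valuation
-- ≥ 1)  and  Polar₂ (odd/even, valuation < 0).
module TwoAdic where
  open import Data.Integer as ℤ using (ℤ; +_)
  open import Data.Rational using (ℚ; _+_; _-_; _*_; ↥_; ↧_)
  open import Data.Integer.Divisibility.Signed using (∣m⇒∣m*n; ∣n⇒∣m*n; ∣m∣n⇒∣m+n)
  open Embedding
  open Fractions
  open Parity

  record Frac₂ (P Q : ℤ → Set) (x : ℚ) : Set where
    constructor frac
    field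
      {num den}  : ℤ
      num-parity : P num
      den-parity : Q den
      represents : x ≈ num ⁄ den

  Unit₂ Even₂ Polar₂ : ℚ → Set
  Unit₂  = Frac₂ IsOdd IsOdd
  Even₂  = Frac₂ IsEven IsOdd
  Polar₂ = Frac₂ IsOdd IsEven

  unit*unit : ∀ {x y} → Unit₂ x → Unit₂ y → Unit₂ (x * y)
  unit*unit (frac a d x≈) (frac b e y≈) = frac (odd*odd a b) (odd*odd d e) (≈-* x≈ y≈)

  unit+unit : ∀ {x y} → Unit₂ x → Unit₂ y → Even₂ (x + y)
  unit+unit (frac a d x≈) (frac b e y≈) =
    frac (odd+odd (odd*odd a e) (odd*odd b d)) (odd*odd d e) (≈-+ x≈ y≈)

  even+unit : ∀ {x y} → Even₂ x → Unit₂ y → Unit₂ (x + y)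
  even+unit (frac a d x≈) (frac {_} {e} b e-odd y≈) =
    frac (even+odd (∣m⇒∣m*n e a) (odd*odd b d)) (odd*odd d e-odd) (≈-+ x≈ y≈)

  even+even : ∀ {x y} → Even₂ x → Even₂ y → Even₂ (x + y)
  even+even (frac {_} {d} a d-odd x≈) (frac {_} {e} b e-odd y≈) =
    frac (∣m∣n⇒∣m+n (∣m⇒∣m*n e a) (∣m⇒∣m*n d b)) (odd*odd d-odd e-odd) (≈-+ x≈ y≈)

  polar*polar : ∀ {x y} → Polar₂ x → Polar₂ y → Polar₂ (x * y)
  polar*polar (frac a d x≈) (frac {_} {e} b _ y≈) = frac (odd*odd a b) (∣m⇒∣m*n e d) (≈-* x≈ y≈)

  polar-unit : ∀ {x y} → Polar₂ x → Unit₂ y → Polar₂ (x - y)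
  polar-unit (frac a d x≈) (frac {n} {e} b e-odd y≈) =
    frac (odd-even (odd*odd a e-odd) (∣n⇒∣m*n n d)) (∣m⇒∣m*n e d) (≈-- x≈ y≈)

  polar-quotient : ∀ {l u v} → l * u ≡ v → Even₂ u → Unit₂ v → Polar₂ l
  polar-quotient {l} {u} {v} lu≡v (frac {b} {e} b-even e-odd (rep u≈)) (frac {c} {f} c-odd f-odd (rep v≈)) =
    frac (odd*odd c-odd e-odd) (∣m⇒∣m*n f b-even) (rep (begin
      l * toℚ (b ℤ.* f)                  ≡⟨ cong (l *_) (toℚ-* b f) ⟩
      l * (toℚ b * toℚ f)                ≡⟨ cong (λ w → l * (w * toℚ f)) u≈ ⟨
      l * (u * toℚ e * toℚ f)            ≡⟨ regroup l u (toℚ e) (toℚ f) ⟩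
      (l * u) * toℚ f * toℚ e            ≡⟨ cong (λ w → w * toℚ f * toℚ e) lu≡v ⟩
      v * toℚ f * toℚ e                  ≡⟨ cong (_* toℚ e) v≈ ⟩
      toℚ c * toℚ e                      ≡⟨ toℚ-* c e ⟨
      toℚ (c ℤ.* e)                      ∎))
    where
    open ≡-Reasoning
    regroup : ∀ l u e f → l * (u * e * f) ≡ (l * u) * f * e
    regroup = solve-∀ ℚ-ring

  polar⇒even-denominator : ∀ {x} → Polar₂ x → IsEven (↧ x)
  polar⇒even-denominator {x} (frac {n} {d} n-odd d-even x≈) with parity (↧ x)
  ... | inj₁ q-even = q-even
  ... | inj₂ q-odd = ⊥-elim (even-odd-disjoint
        (subst IsEven (≈-cross (≈-reduced x) x≈) (∣n⇒∣m*n (↥ x) d-even))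
        (odd*odd n-odd q-odd))

module IntegralModel where
  open import Data.Integer as ℤ using (ℤ; +_; _*_; _-_; 0ℤ; NonZero; ≢-nonZero)
  open import Data.Integer.Properties using (*-cancelˡ-≡; i*j≢0)
  open Fractions
  open Parity
  open TwoAdic

  cleared-curve : ∀ m {x y a b d e} → OnE m (pt x y) → x ≈ a ⁄ d → y ≈ b ⁄ e →
    b * b * (d * d * d) ≡ e * e * (a * a * a - m * (d * d * d))
  cleared-curve m {x} {y} {a} {b} {d} {e} on-curve x≈ y≈ = begin
    b * b * (d * d * d)                       ≡⟨ append-one (b * b) (d * d * d) ⟩
    b * b * (d * d * d * + 1)                 ≡⟨ ≈-cross (≈-* y≈ y≈) rhs≈ ⟩
    (a * a * a * + 1 - m * (d * d * d)) * (e * e)  ≡⟨ rearrange a d e m ⟩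
    e * e * (a * a * a - m * (d * d * d))      ∎
    where
    open ≡-Reasoning
    rhs≈ : y ℚ.* y ≈ a * a * a * + 1 - m * (d * d * d) ⁄ d * d * d * + 1
    rhs≈ = subst (λ z → z ≈ a * a * a * + 1 - m * (d * d * d) ⁄ d * d * d * + 1) (sym on-curve)
                 (≈-- (≈-* (≈-* x≈ x≈) x≈) (≈-integer m))
    append-one : ∀ u v → u * v ≡ u * (v * + 1)
    append-one = solve-∀ ℤ-ring
    rearrange : ∀ a d e m → (a * a * a * + 1 - m * (d * d * d)) * (e * e) ≡ e * e * (a * a * a - m * (d * d * d))
    rearrange = solve-∀ ℤ-ring

  weighted-curve : ∀ m {x y r s t} → t ≢ 0ℤ → OnE m (pt x y) →
    x ≈ r ⁄ t * t → y ≈ s ⁄ t * t * t → s * s ≡ r * r * r - m * ((t * t * t) * (t * t * t))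
  weighted-curve m {x} {y} {r} {s} {t} t≢0 on-curve x≈ y≈ =
    *-cancelˡ-≡ (c * c) _ _ {{c²≢0}} (begin
      c * c * (s * s)                                 ≡⟨ reorder s t ⟩
      s * s * (t * t * (t * t) * (t * t))             ≡⟨ cleared-curve m on-curve x≈ y≈ ⟩
      c * c * (r * r * r - m * (t * t * (t * t) * (t * t)))  ≡⟨ cong (λ w → c * c * (r * r * r - m * w)) (sixth t) ⟩
      c * c * (r * r * r - m * (c * c))               ∎)
    where
    open ≡-Reasoning
    c : ℤ
    c = t * t * t
    instance
      t-nonzero : NonZero t
      t-nonzero = ≢-nonZero t≢0
      t²-nonzero : NonZero (t * t)
      t²-nonzero = i*j≢0 t t
      c-nonzero : NonZero c
      c-nonzero = i*j≢0 (t * t) t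
    c²≢0 : NonZero (c * c)
    c²≢0 = i*j≢0 c c
    reorder : ∀ s t → t * t * t * (t * t * t) * (s * s) ≡ s * s * (t * t * (t * t) * (t * t))
    reorder = solve-∀ ℤ-ring
    sixth : ∀ t → t * t * (t * t) * (t * t) ≡ t * t * t * (t * t * t)
    sixth = solve-∀ ℤ-ring

  odd-denominator-point : ∀ b {x y} → OnE (+ 8 * (b * b * b) ℤ.+ + 3) (pt x y) →
    ∀ r s t → HasForm (pt x y) r s t → IsOdd t → Unit₂ x × Even₂ y
  odd-denominator-point b {x} {y} on-curve r s t (t≢0 , x≈ , y≈ , _) t-odd =
    frac r-odd t²-odd (rep x≈) , frac s-even t³-odd (rep y≈)
    where
    t²-odd : IsOdd (t * t)
    t²-odd = odd*odd t-odd t-odd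
    t³-odd : IsOdd (t * t * t)
    t³-odd = odd*odd t²-odd t-odd
    parities : IsOdd r × IsEven s
    parities = point-parity (b * b * b) r s (t * t * t) t³-odd
                 (weighted-curve (+ 8 * (b * b * b) ℤ.+ + 3) {x} {y} {r} {s} t≢0 on-curve (rep x≈) (rep y≈))
    r-odd : IsOdd r
    r-odd = proj₁ parities
    s-even : IsEven s
    s-even = proj₂ parities

module SquareCube where
  open import Data.Nat using (ℕ; NonZero; _*_; ≢-nonZero)
  import Data.Nat.Properties as ℕ
  open import Data.Nat.Divisibility using (_∣_; divides; ∣-refl)
  import Data.Nat.Coprimality as ℕC
  open import Data.Nat.GCD using (gcd; gcd[m,n]∣m; gcd[m,n]∣n; gcd[m,n]≢0)
  open import Data.Nat.DivMod using (_/_; m/n*n≡m)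

  -- w² = q³ with q ≠ 0:  writing w = w'g, q = q'g with g = gcd(w, q) gives
  -- w'² = q'³ g, so the factor q' of w'² (coprime to w') is 1.
  square-cube : ∀ {w q} → q ≢ 0 → w * w ≡ q * q * q → ∃[ t ] (t * t ≡ q × w ≡ t * q)
  square-cube {w} {q} q≢0 w²≡q³ = w′ , w′²≡q , w≡w′q
    where
    open ≡-Reasoning
    g : ℕ
    g = gcd w q
    instance
      g-nonzero : NonZero g
      g-nonzero = ≢-nonZero (gcd[m,n]≢0 w q (inj₂ q≢0))
      g²-nonzero : NonZero (g * g)
      g²-nonzero = ℕ.m*n≢0 g g
    w′ q′ : ℕ
    w′ = w / g
    q′ = q / g
    w≡w′g : w′ * g ≡ w
    w≡w′g = m/n*n≡m (gcd[m,n]∣m w q)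
    q≡q′g : q′ * g ≡ q
    q≡q′g = m/n*n≡m (gcd[m,n]∣n w q)
    w′²≡q′³g : w′ * w′ ≡ q′ * q′ * q′ * g
    w′²≡q′³g = ℕ.*-cancelˡ-≡ _ _ (g * g) (begin
      g * g * (w′ * w′)               ≡⟨ square-out g w′ ⟩
      (w′ * g) * (w′ * g)             ≡⟨ cong (λ v → v * v) w≡w′g ⟩
      w * w                           ≡⟨ w²≡q³ ⟩
      q * q * q                       ≡⟨ cong (λ v → v * v * v) q≡q′g ⟨
      (q′ * g) * (q′ * g) * (q′ * g)  ≡⟨ cube-out g q′ ⟩
      g * g * (q′ * q′ * q′ * g)      ∎)
      where
      square-out : ∀ g w → g * g * (w * w) ≡ (w * g) * (w * g)
      square-out = solve-∀ ℕ-ring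
      cube-out : ∀ g q → (q * g) * (q * g) * (q * g) ≡ g * g * (q * q * q * g)
      cube-out = solve-∀ ℕ-ring
    q′∣w′ : q′ ∣ w′
    q′∣w′ = ℕC.coprime-divisor (ℕC.sym (ℕC.coprime-/gcd w q))
              (divides (q′ * q′ * g) (trans w′²≡q′³g (rotate q′ g)))
      where
      rotate : ∀ q g → q * q * q * g ≡ q * q * g * q
      rotate = solve-∀ ℕ-ring
    q′≡1 : q′ ≡ 1
    q′≡1 = ℕC.coprime-/gcd w q (q′∣w′ , ∣-refl)
    q≡g : q ≡ g
    q≡g = trans (sym q≡q′g) (trans (cong (_* g) q′≡1) (ℕ.*-identityˡ g))
    w′²≡q : w′ * w′ ≡ q
    w′²≡q = trans w′²≡q′³g (trans (cong (λ v → v * v * v * g) q′≡1) (trans (ℕ.*-identityˡ g) (sym q≡g)))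
    w≡w′q : w ≡ w′ * q
    w≡w′q = trans (sym w≡w′g) (cong (w′ *_) (sym q≡g))

-- In lowest terms x = p/q, y = u/w, the
-- cleared equation u²q³ = w²(p³ - m q³) forces w² ∣ q³ (as w ⊥ u) and
-- q³ ∣ w² (as q ⊥ p³ - m q³), hence w² = q³, hence q = t² and w = t³.
module LowestTerms where
  import Data.Nat as ℕ
  import Data.Nat.Properties as ℕ
  import Data.Nat.Divisibility as ℕ∣
  import Data.Nat.Coprimality as ℕC
  open import Data.Integer using (ℤ; +_; _*_; _+_; _-_; ∣_∣)
  open import Data.Integer.Properties using (abs-*; pos-*; +-injective; *-comm)
  open import Data.Integer.Coprimality using (Coprime; coprime-divisor)
  open import Data.Integer.GCD using (gcd)
  import Data.Integer.Coprimality as Coprime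
  open import Data.Integer.Divisibility using (_∣_)
  import Data.Integer.Divisibility.Signed as Signed
  open import Data.Rational as ℚ using (ℚ; mkℚ; ↥_; ↧_; ↧ₙ_)
  open Embedding
  open Fractions
  open IntegralModel
  open SquareCube

  coprime-*ʳ : ∀ {i j k} → Coprime i j → Coprime i k → Coprime i (j * k)
  coprime-*ʳ {i} {j} {k} i⊥j i⊥k = subst (ℕC.Coprime ∣ i ∣) (sym (abs-* j k)) i⊥jk
    where
    i⊥jk : ℕC.Coprime ∣ i ∣ (∣ j ∣ ℕ.* ∣ k ∣)
    i⊥jk (d∣i , d∣jk) = i⊥k (d∣i , ℕC.coprime-divisor d⊥j d∣jk)
      where
      d⊥j : ℕC.Coprime _ ∣ j ∣
      d⊥j (e∣d , e∣j) = i⊥j (ℕ∣.∣-trans e∣d d∣i , e∣j)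

  coprime-*ˡ : ∀ {i j k} → Coprime i k → Coprime j k → Coprime (i * j) k
  coprime-*ˡ {i} {j} {k} i⊥k j⊥k = Coprime.sym {k} {i * j} (coprime-*ʳ {k} {i} {j} (Coprime.sym {i} {k} i⊥k) (Coprime.sym {j} {k} j⊥k))

  coprime-square : ∀ {i j} → Coprime i j → Coprime (i * i) (j * j)
  coprime-square {i} {j} i⊥j = coprime-*ˡ {i} {i} {j * j} i⊥j² i⊥j²
    where
    i⊥j² : Coprime i (j * j)
    i⊥j² = coprime-*ʳ {i} {j} {j} i⊥j i⊥j

  coprime-cube : ∀ {i j} → Coprime i j → Coprime (i * i * i) (j * j * j)
  coprime-cube {i} {j} i⊥j = coprime-*ˡ {i * i} {i} {j * j * j} (coprime-*ˡ {i} {i} {j * j * j} i⊥j³ i⊥j³) i⊥j³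
    where
    i⊥j³ : Coprime i (j * j * j)
    i⊥j³ = coprime-*ʳ {i} {j * j} {j} (coprime-*ʳ {i} {j} {j} i⊥j i⊥j) i⊥j

  reduced-coprime : ∀ x → Coprime (↥ x) (↧ x)
  reduced-coprime (mkℚ _ _ coprime) = ℕC.recompute coprime

  cube-denominators : ∀ m p u q w → Coprime p q → Coprime u w →
    u * u * (q * q * q) ≡ w * w * (p * p * p - m * (q * q * q)) → ∣ w * w ∣ ≡ ∣ q * q * q ∣
  cube-denominators m p u q w p⊥q u⊥w cleared = ℕ∣.∣-antisym w²∣q³ q³∣w²
    where
    K : ℤ
    K = p * p * p - m * (q * q * q)
    w²∣q³ : w * w ∣ q * q * q
    w²∣q³ = coprime-divisor (w * w) (u * u) (q * q * q) (coprime-square {w} {u} (Coprime.sym {u} {w} u⊥w))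
              (Signed.∣⇒∣ᵤ {w * w} {u * u * (q * q * q)} (Signed.divides K (trans cleared (*-comm (w * w) K))))
    q³⊥K : Coprime (q * q * q) K
    q³⊥K {d} (d∣q³ , d∣K) = coprime-cube {p} {q} p⊥q (Signed.∣⇒∣ᵤ {+ d} {p * p * p} d∣p³ , d∣q³)
      where
      d∣p³ : + d Signed.∣ p * p * p
      d∣p³ = subst (+ d Signed.∣_) (restore p q m)
               (Signed.∣m∣n⇒∣m+n (Signed.∣ᵤ⇒∣ {+ d} {K} d∣K) (Signed.∣n⇒∣m*n m (Signed.∣ᵤ⇒∣ {+ d} {q * q * q} d∣q³)))
        where
        restore : ∀ p q m → p * p * p - m * (q * q * q) + m * (q * q * q) ≡ p * p * p
        restore = solve-∀ ℤ-ring
    q³∣w² : q * q * q ∣ w * w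
    q³∣w² = coprime-divisor (q * q * q) K (w * w) q³⊥K
              (Signed.∣⇒∣ᵤ {q * q * q} {K * (w * w)} (Signed.divides (u * u) (trans (*-comm K (w * w)) (sym cleared))))

  reduced-denominators : ∀ m {x y} → OnE m (pt x y) → ↧ₙ y ℕ.* ↧ₙ y ≡ ↧ₙ x ℕ.* ↧ₙ x ℕ.* ↧ₙ x
  reduced-denominators m {x} {y} on-curve = begin
    w ℕ.* w                 ≡⟨ abs-* (+ w) (+ w) ⟨
    ∣ + w * + w ∣           ≡⟨ cube-denominators m (↥ x) (↥ y) (+ q) (+ w) (reduced-coprime x) (reduced-coprime y)
                                 (cleared-curve m on-curve (≈-reduced x) (≈-reduced y)) ⟩
    ∣ + q * + q * + q ∣     ≡⟨ abs-* (+ q * + q) (+ q) ⟩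
    ∣ + q * + q ∣ ℕ.* q     ≡⟨ cong (ℕ._* q) (abs-* (+ q) (+ q)) ⟩
    q ℕ.* q ℕ.* q           ∎
    where
    open ≡-Reasoning
    q w : ℕ.ℕ
    q = ↧ₙ x
    w = ↧ₙ y

  reduced-form : ∀ m {x y} → OnE m (pt x y) →
    ∃[ t ] (t ℕ.* t ≡ ↧ₙ x × HasForm (pt x y) (↥ x) (↥ y) (+ t))
  reduced-form m {x} {y} on-curve =
    t , t²≡q , t≢0 , x-form , y-form , gcd≡1 {↥ x} (reduced-coprime x) t∣q , gcd≡1 {↥ y} (reduced-coprime y) t∣w
    where
    q w : ℕ.ℕ
    q = ↧ₙ x
    w = ↧ₙ y
    root : ∃[ t ] (t ℕ.* t ≡ q × w ≡ t ℕ.* q)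
    root = square-cube (λ ()) (reduced-denominators m {x} {y} on-curve)
    t : ℕ.ℕ
    t = proj₁ root
    t²≡q : t ℕ.* t ≡ q
    t²≡q = proj₁ (proj₂ root)
    w≡tq : w ≡ t ℕ.* q
    w≡tq = proj₂ (proj₂ root)
    t∣q : t ℕ∣.∣ q
    t∣q = ℕ∣.divides t (sym t²≡q)
    t∣w : t ℕ∣.∣ w
    t∣w = ℕ∣.divides q (trans w≡tq (ℕ.*-comm t q))
    t≢0 : + t ≢ + 0
    t≢0 t≡0 = ℕ.0≢1+n (trans (cong (λ v → v ℕ.* v) (sym (+-injective t≡0))) t²≡q)
    t²≡+q : + t * + t ≡ + q
    t²≡+q = trans (sym (pos-* t t)) (cong +_ t²≡q)
    x-form : x ℚ.* toℚ (+ t * + t) ≡ toℚ (↥ x)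
    x-form = trans (cong (λ v → x ℚ.* toℚ v) t²≡+q) (times-denominator x)
    t³≡+w : + t * + t * + t ≡ + w
    t³≡+w = trans (cong (_* + t) t²≡+q) (trans (sym (pos-* q t)) (cong +_ (trans (ℕ.*-comm q t) (sym w≡tq))))
    y-form : y ℚ.* toℚ (+ t * + t * + t) ≡ toℚ (↥ y)
    y-form = trans (cong (λ v → y ℚ.* toℚ v) t³≡+w) (times-denominator y)
    -- coprimality passes to divisors, and integer gcd is the gcd of absolute values
    gcd≡1 : ∀ {p n} → Coprime p (+ n) → t ℕ∣.∣ n → gcd p (+ t) ≡ + 1
    gcd≡1 p⊥n t∣n = cong +_ (ℕC.coprime⇒gcd≡1 (λ (d∣p , d∣t) → p⊥n (d∣p , ℕ∣.∣-trans d∣t t∣n)))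

module Chord where
  open import Data.Rational using (ℚ; 0ℚ; 1ℚ; _+_; _-_; _*_; ≢-nonZero)
  open import Data.Rational.Properties
    using (_≟_; *-inverseʳ; *-identityˡ; *-identityʳ; *-comm; *-assoc; *-zeroʳ; +-inverseʳ; +-0-group)
  open import Algebra.Properties.Group +-0-group using (x∙y⁻¹≈ε⇒x≈y)

  inv-inverse : ∀ d → d ≢ 0ℚ → d * inv d ≡ 1ℚ
  inv-inverse d d≢0 with d ≟ 0ℚ
  ... | yes d≡0 = ⊥-elim (d≢0 d≡0)
  ... | no d≢0′ = *-inverseʳ d {{≢-nonZero d≢0′}}

  zero-product : ∀ {a b} → a ≢ 0ℚ → a * b ≡ 0ℚ → b ≡ 0ℚ
  zero-product {a} {b} a≢0 ab≡0 = begin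
    b                  ≡⟨ *-identityˡ b ⟨
    1ℚ * b             ≡⟨ cong (_* b) (inv-inverse a a≢0) ⟨
    (a * inv a) * b    ≡⟨ swap a (inv a) b ⟩
    inv a * (a * b)    ≡⟨ cong (inv a *_) ab≡0 ⟩
    inv a * 0ℚ         ≡⟨ *-zeroʳ (inv a) ⟩
    0ℚ                 ∎
    where
    open ≡-Reasoning
    swap : ∀ a i b → (a * i) * b ≡ i * (a * b)
    swap = solve-∀ ℚ-ring

  difference-nonzero : ∀ {x₁ x₂} → x₁ ≢ x₂ → x₂ - x₁ ≢ 0ℚ
  difference-nonzero x₁≢x₂ d≡0 = x₁≢x₂ (sym (x∙y⁻¹≈ε⇒x≈y _ _ d≡0))

  defect : ℚ → ℚ → ℚ → ℚ
  defect M x y = (x * x * x - M) - y * y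

  on-curve⇒defect≡0 : ∀ M x y → y * y ≡ x * x * x - M → defect M x y ≡ 0ℚ
  on-curve⇒defect≡0 M x y on = trans (cong (λ v → (x * x * x - M) - v) on) (+-inverseʳ (x * x * x - M))

  defect≡0⇒on-curve : ∀ M x y → defect M x y ≡ 0ℚ → y * y ≡ x * x * x - M
  defect≡0⇒on-curve M x y d≡0 = sym (x∙y⁻¹≈ε⇒x≈y _ _ d≡0)

  chord-slope : ∀ x₁ y₁ x₂ y₂ → x₁ ≢ x₂ → (y₂ - y₁) * inv (x₂ - x₁) * (x₂ - x₁) ≡ y₂ - y₁
  chord-slope x₁ y₁ x₂ y₂ x₁≢x₂ = begin
    (y₂ - y₁) * inv (x₂ - x₁) * (x₂ - x₁)    ≡⟨ *-assoc (y₂ - y₁) _ _ ⟩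
    (y₂ - y₁) * (inv (x₂ - x₁) * (x₂ - x₁))  ≡⟨ cong ((y₂ - y₁) *_) (*-comm (inv (x₂ - x₁)) _) ⟩
    (y₂ - y₁) * ((x₂ - x₁) * inv (x₂ - x₁))  ≡⟨ cong ((y₂ - y₁) *_) (inv-inverse _ (difference-nonzero x₁≢x₂)) ⟩
    (y₂ - y₁) * 1ℚ                          ≡⟨ *-identityʳ (y₂ - y₁) ⟩
    y₂ - y₁                                 ∎
    where open ≡-Reasoning

  -- On the curve the chord slope also equals (x₁² + x₁x₂ + x₂²)/(y₁ + y₂):
  -- multiplied by x₂ - x₁ ≠ 0, the difference is y₂² - y₁² - (x₂³ - x₁³) = 0.
  chord-slope-sum : ∀ {M x₁ y₁ x₂ y₂ l} → y₁ * y₁ ≡ x₁ * x₁ * x₁ - M → y₂ * y₂ ≡ x₂ * x₂ * x₂ - M →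
    x₁ ≢ x₂ → l * (x₂ - x₁) ≡ y₂ - y₁ → l * (y₁ + y₂) ≡ x₁ * x₁ + x₁ * x₂ + x₂ * x₂
  chord-slope-sum {M} {x₁} {y₁} {x₂} {y₂} {l} on₁ on₂ x₁≢x₂ slope =
    x∙y⁻¹≈ε⇒x≈y _ _ (zero-product (difference-nonzero x₁≢x₂) (begin
      (x₂ - x₁) * (l * (y₁ + y₂) - S)              ≡⟨ expand l x₁ x₂ y₁ y₂ ⟩
      l * (x₂ - x₁) * (y₁ + y₂) - (x₂ * x₂ * x₂ - x₁ * x₁ * x₁)  ≡⟨ cong (λ v → v * (y₁ + y₂) - (x₂ * x₂ * x₂ - x₁ * x₁ * x₁)) slope ⟩
      (y₂ - y₁) * (y₁ + y₂) - (x₂ * x₂ * x₂ - x₁ * x₁ * x₁)  ≡⟨ as-defects x₁ x₂ y₁ y₂ M ⟩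
      defect M x₁ y₁ - defect M x₂ y₂                  ≡⟨ cong₂ _-_ (on-curve⇒defect≡0 M x₁ y₁ on₁) (on-curve⇒defect≡0 M x₂ y₂ on₂) ⟩
      0ℚ - 0ℚ                                          ≡⟨ +-inverseʳ 0ℚ ⟩
      0ℚ                                               ∎))
    where
    open ≡-Reasoning
    S = x₁ * x₁ + x₁ * x₂ + x₂ * x₂
    expand : ∀ l x₁ x₂ y₁ y₂ → (x₂ - x₁) * (l * (y₁ + y₂) - (x₁ * x₁ + x₁ * x₂ + x₂ * x₂))
           ≡ l * (x₂ - x₁) * (y₁ + y₂) - (x₂ * x₂ * x₂ - x₁ * x₁ * x₁)
    expand = solve-∀ ℚ-ring
    as-defects : ∀ x₁ x₂ y₁ y₂ M → (y₂ - y₁) * (y₁ + y₂) - (x₂ * x₂ * x₂ - x₁ * x₁ * x₁)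
               ≡ ((x₁ * x₁ * x₁ - M) - y₁ * y₁) - ((x₂ * x₂ * x₂ - M) - y₂ * y₂)
    as-defects = solve-∀ ℚ-ring

  -- The defect along the chord is a monic cubic in x with roots x₁, x₂ and
  -- root sum l², so its value at x₃ = l² - x₁ - x₂ is determined by its
  -- values at x₁ and x₂ (interpolation), which are 0.
  chord-third-point : ∀ {M x₁ y₁ x₂ y₂ l} → y₁ * y₁ ≡ x₁ * x₁ * x₁ - M → y₂ * y₂ ≡ x₂ * x₂ * x₂ - M →
    x₁ ≢ x₂ → l * (x₂ - x₁) ≡ y₂ - y₁ →
    let x₃ = l * l - x₁ - x₂ in (l * (x₁ - x₃) - y₁) * (l * (x₁ - x₃) - y₁) ≡ x₃ * x₃ * x₃ - M
  chord-third-point {M} {x₁} {y₁} {x₂} {y₂} {l} on₁ on₂ x₁≢x₂ slope =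
    trans (reflect l x₁ x₂ y₁)
      (defect≡0⇒on-curve M x₃ (line x₃) (zero-product (difference-nonzero x₁≢x₂) (begin
        (x₂ - x₁) * defect M x₃ (line x₃)
          ≡⟨ interpolation M l x₁ x₂ y₁ ⟩
        (x₂ - x₁) * defect M x₁ y₁ + (defect M x₂ (line x₂) - defect M x₁ y₁) * (x₃ - x₁)
          ≡⟨ cong₂ (λ u v → (x₂ - x₁) * u + (v - u) * (x₃ - x₁)) (on-curve⇒defect≡0 M x₁ y₁ on₁) on-line ⟩
        (x₂ - x₁) * 0ℚ + (0ℚ - 0ℚ) * (x₃ - x₁)
          ≡⟨ vanish (x₂ - x₁) (x₃ - x₁) ⟩
        0ℚ ∎)))
    where
    open ≡-Reasoning
    x₃ = l * l - x₁ - x₂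
    line : ℚ → ℚ
    line x = l * (x - x₁) + y₁
    on-line : defect M x₂ (line x₂) ≡ 0ℚ
    on-line = on-curve⇒defect≡0 M x₂ (line x₂) (trans (cong (λ v → (v + y₁) * (v + y₁)) slope)
                                       (trans (cong (λ v → v * v) (cancel y₁ y₂)) on₂))
      where
      cancel : ∀ y₁ y₂ → y₂ - y₁ + y₁ ≡ y₂
      cancel = solve-∀ ℚ-ring
    interpolation : ∀ M l x₁ x₂ y₁ → let x₃ = l * l - x₁ - x₂ in
      (x₂ - x₁) * ((x₃ * x₃ * x₃ - M) - (l * (x₃ - x₁) + y₁) * (l * (x₃ - x₁) + y₁))
      ≡ (x₂ - x₁) * ((x₁ * x₁ * x₁ - M) - y₁ * y₁)
        + (((x₂ * x₂ * x₂ - M) - (l * (x₂ - x₁) + y₁) * (l * (x₂ - x₁) + y₁)) - ((x₁ * x₁ * x₁ - M) - y₁ * y₁)) * (x₃ - x₁)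
    interpolation = solve-∀ ℚ-ring
    vanish : ∀ a b → a * 0ℚ + (0ℚ - 0ℚ) * b ≡ 0ℚ
    vanish = solve-∀ ℚ-ring
    reflect : ∀ l x₁ x₂ y₁ → let x₃ = l * l - x₁ - x₂ in
      (l * (x₁ - x₃) - y₁) * (l * (x₁ - x₃) - y₁) ≡ (l * (x₃ - x₁) + y₁) * (l * (x₃ - x₁) + y₁)
    reflect = solve-∀ ℚ-ring

module GroupLaw where
  open import Data.Integer using (+_; -[1+_])
  open import Data.Rational using (0ℚ; _+_; _-_; _*_)
  open import Data.Rational.Properties using (_≟_; +-inverseʳ)
  open Chord using (zero-product)

  add-opposite : ∀ {x₁ y₁ x₂ y₂} → x₁ ≡ x₂ → y₁ + y₂ ≡ 0ℚ → add (pt x₁ y₁) (pt x₂ y₂) ≡ O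
  add-opposite {x₁} {y₁} {x₂} {y₂} x₁≡x₂ y₁+y₂≡0 with x₁ ≟ x₂
  ... | no x₁≢x₂ = ⊥-elim (x₁≢x₂ x₁≡x₂)
  ... | yes _ with y₁ + y₂ ≟ 0ℚ
  ...   | yes _ = refl
  ...   | no y₁+y₂≢0 = ⊥-elim (y₁+y₂≢0 y₁+y₂≡0)

  add-chord : ∀ {x₁ y₁ x₂ y₂} → x₁ ≢ x₂ →
    let l = (y₂ - y₁) * inv (x₂ - x₁) in
    add (pt x₁ y₁) (pt x₂ y₂) ≡ pt (l * l - x₁ - x₂) (l * (x₁ - (l * l - x₁ - x₂)) - y₁)
  add-chord {x₁} {y₁} {x₂} {y₂} x₁≢x₂ with x₁ ≟ x₂
  ... | no _ = refl
  ... | yes x₁≡x₂ = ⊥-elim (x₁≢x₂ x₁≡x₂)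

  1≢0 : + 1 ≢ + 0
  1≢0 ()

  -- Independent points of E_m have distinct abscissae: with equal abscissae
  -- y₁ = ±y₂, so P + Q = O or P - Q = O.
  distinct-abscissae : ∀ m {x₁ y₁ x₂ y₂} → OnE m (pt x₁ y₁) → OnE m (pt x₂ y₂) →
    Independent (pt x₁ y₁) (pt x₂ y₂) → x₁ ≢ x₂
  distinct-abscissae m {x₁} {y₁} {x₂} {y₂} on₁ on₂ indep x₁≡x₂ with y₁ + y₂ ≟ 0ℚ
  ... | yes y₁+y₂≡0 = 1≢0 (proj₁ (indep (+ 1) (+ 1) (add-opposite x₁≡x₂ y₁+y₂≡0)))
  ... | no y₁+y₂≢0 = 1≢0 (proj₁ (indep (+ 1) -[1+ 0 ] (add-opposite x₁≡x₂ y₁-y₂≡0)))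
    where
    open ≡-Reasoning
    y₁²≡y₂² : y₁ * y₁ ≡ y₂ * y₂
    y₁²≡y₂² = trans on₁ (trans (cong (λ v → v * v * v - toℚ m) x₁≡x₂) (sym on₂))
    y₁-y₂≡0 : y₁ - y₂ ≡ 0ℚ
    y₁-y₂≡0 = zero-product y₁+y₂≢0 (begin
      (y₁ + y₂) * (y₁ - y₂)  ≡⟨ difference-of-squares y₁ y₂ ⟩
      y₁ * y₁ - y₂ * y₂      ≡⟨ cong (λ v → v - y₂ * y₂) y₁²≡y₂² ⟩
      y₂ * y₂ - y₂ * y₂      ≡⟨ +-inverseʳ (y₂ * y₂) ⟩
      0ℚ                     ∎)
      where
      difference-of-squares : ∀ a b → (a + b) * (a - b) ≡ a * a - b * b
      difference-of-squares = solve-∀ ℚ-ring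

module ChordSum where
  import Data.Nat as ℕ
  open import Data.Nat.Primality using (euclidsLemma; prime[2])
  open import Data.Sum using (reduce)
  open import Data.Integer using (ℤ; +_; _+_; _*_)
  open import Data.Integer.Divisibility using (_∣_)
  open import Data.Integer.Divisibility.Signed using (∣⇒∣ᵤ)
  open import Data.Rational as ℚ using (ℚ; ↥_; ↧ₙ_)
  open Parity using (IsOdd)
  open TwoAdic
  open IntegralModel using (odd-denominator-point)
  open LowestTerms using (reduced-form)
  open Chord
  open GroupLaw using (add-chord)

  chord-sum-even-denominator : ∀ b {x₁ y₁ x₂ y₂} →
    let m = + 8 * (b * b * b) + + 3 in
    OnE m (pt x₁ y₁) → OnE m (pt x₂ y₂) → x₁ ≢ x₂ →
    ∀ r₁ s₁ t₁ → HasForm (pt x₁ y₁) r₁ s₁ t₁ → IsOdd t₁ →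
    ∀ r₂ s₂ t₂ → HasForm (pt x₂ y₂) r₂ s₂ t₂ → IsOdd t₂ →
    ∃[ r ] ∃[ s ] ∃[ t ] (HasForm (add (pt x₁ y₁) (pt x₂ y₂)) r s t × + 2 ∣ t)
  chord-sum-even-denominator b {x₁} {y₁} {x₂} {y₂} on₁ on₂ x₁≢x₂ r₁ s₁ t₁ form₁ t₁-odd r₂ s₂ t₂ form₂ t₂-odd =
    subst (λ R → ∃[ r ] ∃[ s ] ∃[ t ] (HasForm R r s t × + 2 ∣ t)) (sym (add-chord x₁≢x₂))
      (↥ x₃ , ↥ y₃ , + t , form₃ , 2∣t)
    where
    m : ℤ
    m = + 8 * (b * b * b) + + 3
    l x₃ y₃ : ℚ
    l = (y₂ ℚ.- y₁) ℚ.* inv (x₂ ℚ.- x₁)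
    x₃ = l ℚ.* l ℚ.- x₁ ℚ.- x₂
    y₃ = l ℚ.* (x₁ ℚ.- x₃) ℚ.- y₁
    slope : l ℚ.* (x₂ ℚ.- x₁) ≡ y₂ ℚ.- y₁
    slope = chord-slope x₁ y₁ x₂ y₂ x₁≢x₂
    P₁ : Unit₂ x₁ × Even₂ y₁
    P₁ = odd-denominator-point b on₁ r₁ s₁ t₁ form₁ t₁-odd
    P₂ : Unit₂ x₂ × Even₂ y₂
    P₂ = odd-denominator-point b on₂ r₂ s₂ t₂ form₂ t₂-odd
    l-polar : Polar₂ l
    l-polar = polar-quotient (chord-slope-sum {toℚ m} {x₁} {y₁} {x₂} {y₂} {l} on₁ on₂ x₁≢x₂ slope)
                (even+even (proj₂ P₁) (proj₂ P₂))
                (even+unit (unit+unit (unit*unit (proj₁ P₁) (proj₁ P₁)) (unit*unit (proj₁ P₁) (proj₁ P₂)))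
                           (unit*unit (proj₁ P₂) (proj₁ P₂)))
    x₃-polar : Polar₂ x₃
    x₃-polar = polar-unit (polar-unit (polar*polar l-polar l-polar) (proj₁ P₁)) (proj₁ P₂)
    reduced : ∃[ t ] (t ℕ.* t ≡ ↧ₙ x₃ × HasForm (pt x₃ y₃) (↥ x₃) (↥ y₃) (+ t))
    reduced = reduced-form m {x₃} {y₃} (chord-third-point {toℚ m} {x₁} {y₁} {x₂} {y₂} {l} on₁ on₂ x₁≢x₂ slope)
    t : ℕ.ℕ
    t = proj₁ reduced
    form₃ : HasForm (pt x₃ y₃) (↥ x₃) (↥ y₃) (+ t)
    form₃ = proj₂ (proj₂ reduced)
    2∣t : + 2 ∣ + t
    2∣t = reduce (euclidsLemma t t prime[2]
            (subst (λ n → + 2 ∣ + n) (sym (proj₁ (proj₂ reduced))) (∣⇒∣ᵤ (polar⇒even-denominator x₃-polar))))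

open import Data.Integer using (ℤ; +_; _+_; _*_)
open import Data.Integer.Divisibility using (_∣_)
open Parity using (odd⇒IsOdd)
open GroupLaw using (distinct-abscissae)
open ChordSum using (chord-sum-even-denominator)

-- neither coordinate may be the point at infinity (HasForm O is empty), and
-- independent points have distinct abscissae
mainTheorem8 : (b : ℤ) → Odd b → SquareFree (+ 8 * (b * b * b) + + 3) →
    let m = + 8 * (b * b * b) + + 3 in
    (P Q : Pt) → OnE m P → OnE m Q → Independent P Q →
    (r₁ s₁ t₁ : ℤ) → HasForm P r₁ s₁ t₁ → Odd t₁ →
    (r₂ s₂ t₂ : ℤ) → HasForm Q r₂ s₂ t₂ → Odd t₂ →
    ∃[ r ] ∃[ s ] ∃[ t ] (HasForm (add P Q) r s t × + 2 ∣ t)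
mainTheorem8 b _ _ O _ _ _ _ _ _ _ () _ _ _ _ _ _
mainTheorem8 b _ _ (pt _ _) O _ _ _ _ _ _ _ _ _ _ _ () _
mainTheorem8 b _ _ (pt x₁ y₁) (pt x₂ y₂) on₁ on₂ indep r₁ s₁ t₁ form₁ t₁-odd r₂ s₂ t₂ form₂ t₂-odd =
  chord-sum-even-denominator b on₁ on₂ (distinct-abscissae m on₁ on₂ indep)
    r₁ s₁ t₁ form₁ (odd⇒IsOdd t₁-odd) r₂ s₂ t₂ form₂ (odd⇒IsOdd t₂-odd)
  where m = + 8 * (b * b * b) + + 3
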